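{- Let $(X,\nabla)$ be a skew two-graph and let $w\in X$. Then $(X,\nabla)$ is regular if and only if the descendent tournament $T_w$ is doubly regular.
   Context: $X$ is a finite set and $\mathcal C_3$ denotes the set of all $3$-cycles in the symmetric group on $X$. A skew two-graph is a pair $(X,\nabla)$ with $\nabla\subseteq\mathcal C_3$ such that (S1) for every $\tau\in\mathcal C_3$ exactly one of $\tau,\tau^{ -1}$ lies in $\nabla$, and (S2) for every $4$-subset $\{x,y,z,w\}\subseteq X$, $\nabla$ contains an even number of the $3$-cycles $(xyz),(xwy),(xzw),(ywz)$. For distinct $x,y\in X$ the degree of $(x,y)$ is the number of $z\in X$ with $(xyz)\in\nabla$; $(X,\nabla)$ is regular if all ordered pairs of distinct points have the same degree. The descendent tournament $T_w$ has vertex set $X\setminus\{w\}$ and arc set $E_w=\{(y,z)\in (X\setminus\{w\})^2: (wyz)\in\nabla\}$. A tournament is doubly regular if the number of common out-neighbours of two vertices $x,y$ depends only on whether $x=y$ or not. -}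

module Defs where

open import Data.Nat using (ℕ; zero; suc; _+_)
open import Data.Nat.Divisibility using (_∣_)
open import Data.Fin using (Fin; zero; suc; _≟_)
open import Data.Bool using (Bool; true; false; not; _∧_; if_then_else_)
open import Data.Product using (∃; _×_)
open import Relation.Nullary using (¬_; does)
open import Relation.Binary.PropositionalEquality using (_≡_; _≢_)

count : ∀ {n} → (Fin n → Bool) → ℕ
count {zero}  p = 0
count {suc n} p = (if p zero then 1 else 0) + count (λ i → p (suc i))

count4 : Bool → Bool → Bool → Bool → ℕ
count4 a b c d = b2n a + b2n b + b2n c + b2n d
  where
  b2n : Bool → ℕ
  b2n true  = 1
  b2n false = 0

-- A set ∇ of 3-cycles is encoded by its indicator on ordered
-- triples of distinct points: cyc x y z = true iff the 3-cycle (x y z) ∈ ∇.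
-- Since (x y z) = (y z x) as permutations, the indicator is rotation-invariant,
-- and it is false on triples that are not distinct (those are not 3-cycles).
-- The inverse of (x y z) is (x z y).
record SkewTwoGraph (n : ℕ) : Set where
  field
    cyc       : Fin n → Fin n → Fin n → Bool
    only3cyc  : ∀ x y z → cyc x y z ≡ true → (x ≢ y) × (y ≢ z) × (x ≢ z)
    rotate    : ∀ x y z → cyc x y z ≡ cyc y z x
    S1        : ∀ x y z → x ≢ y → y ≢ z → x ≢ z → cyc x y z ≡ not (cyc x z y)
    S2        : ∀ x y z w → x ≢ y → x ≢ z → x ≢ w → y ≢ z → y ≢ w → z ≢ w →
                2 ∣ count4 (cyc x y z) (cyc x w y) (cyc x z w) (cyc y w z)

open SkewTwoGraph public

degree : ∀ {n} → SkewTwoGraph n → Fin n → Fin n → ℕ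
degree G x y = count (λ z → cyc G x y z)

Regular : ∀ {n} → SkewTwoGraph n → Set
Regular {n} G = ∃ λ k → ∀ (x y : Fin n) → x ≢ y → degree G x y ≡ k

arcT : ∀ {n} → SkewTwoGraph n → Fin n → Fin n → Fin n → Bool
arcT G w y z = not (does (y ≟ w)) ∧ not (does (z ≟ w)) ∧ cyc G w y z

commonOut : ∀ {n} → SkewTwoGraph n → Fin n → Fin n → Fin n → ℕ
commonOut G w x y = count (λ z → not (does (z ≟ w)) ∧ arcT G w x z ∧ arcT G w y z)

DoublyRegularT : ∀ {n} → SkewTwoGraph n → Fin n → Set
DoublyRegularT {n} G w =
  ∃ λ a → ∃ λ b → ∀ (x y : Fin n) → x ≢ w → y ≢ w →
    (x ≡ y → commonOut G w x y ≡ a) × (x ≢ y → commonOut G w x y ≡ b)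

-- By (S2) on {x, y, z, w}, for distinct x, y, z ≠ w we have
-- (x y z) ∈ ∇ ⇔ (y → x) ⊕ (x → z) ⊕ (z → y) in T_w. So for an arc u → v a point z ≠ w
-- counts towards the degree of (u, v) iff it is a common out- or in-neighbour of u and v,
-- and towards that of (v, u) iff it lies on a 2-path between them; w counts towards the
-- former, and the degrees of (w, y) and (x, w) are the out-degree of y and the in-degree
-- of x. Splitting out- and in-degrees of u and v along the arc links all these counts:
-- if every degree is k they force k = 1 + 2λ with λ the common out-degree of u and v.
-- Conversely, if T_w is doubly regular with parameters (a, b), double counting arcs in the
-- regular tournaments T_w and N⁺(u) gives in-degrees a and a = 2b + 1, after which the
-- same relations make every degree equal to a.

module Submission where

open import Defs
open import Algebra.Bundles using (CommutativeMonoid)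
open import Data.Bool using (Bool; true; false; not; _∧_; _xor_; if_then_else_)
open import Data.Bool.Properties using (∧-assoc; ∧-comm; ∧-idem; ¬-not; ∧-commutativeMonoid)
open import Data.Fin using (Fin; zero; suc; _≟_)
open import Data.Nat using (ℕ; zero; suc; _+_; _*_; ⌊_/2⌋; NonZero; ≢-nonZero)
open import Data.Nat.Divisibility using (_∣_; _∤_; _∣?_)
open import Data.Nat.Properties
  using (+-*-semiring; +-comm; +-identityʳ; *-suc; *-distribˡ-+; *-cancelˡ-≡;
         +-cancelˡ-≡; +-cancelʳ-≡; suc-injective; 0≢1+n; n≡⌈n+n/2⌉)
open import Data.Product using (_,_; proj₁; proj₂)
open import Data.Sum using (_⊎_; inj₁; inj₂)
open import Function.Base using (_∘_)
open import Function.Bundles using (_⇔_; mk⇔)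
open import Relation.Nullary using (does; yes; no; contradiction)
open import Relation.Nullary.Decidable using (from-no)
open import Relation.Binary.PropositionalEquality
  using (_≡_; _≢_; refl; sym; trans; cong; cong₂; ≢-sym; module ≡-Reasoning)
open import Algebra.Properties.Semiring.Sum +-*-semiring
  using (sum; sum-cong-≗; sum-replicate-zero; ∑-distrib-+; ∑-comm; *-distribʳ-sum)
open import Algebra.Properties.CommutativeSemigroup
  (CommutativeMonoid.commutativeSemigroup ∧-commutativeMonoid) using (x∙yz≈y∙xz)

open ≡-Reasoning

[_] : Bool → ℕ
[ b ] = if b then 1 else 0

[]-split : ∀ a b → [ a ] ≡ [ a ∧ b ] + [ a ∧ not b ]
[]-split true  true  = refl
[]-split true  false = refl
[]-split false _     = refl

∧-trueˡ : ∀ {a b} → a ∧ b ≡ true → a ≡ true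
∧-trueˡ {true}  _  = refl
∧-trueˡ {false} ()

∧-trueʳ : ∀ {a b} → a ∧ b ≡ true → b ≡ true
∧-trueʳ {true}  b≡true = b≡true
∧-trueʳ {false} ()

count≡sum : ∀ {n} (p : Fin n → Bool) → count p ≡ sum ([_] ∘ p)
count≡sum {zero}  p = refl
count≡sum {suc n} p = cong ([ p zero ] +_) (count≡sum (p ∘ suc))

count-cong : ∀ {n} {p q : Fin n → Bool} → (∀ z → p z ≡ q z) → count p ≡ count q
count-cong {zero}  _   = refl
count-cong {suc n} p≗q = cong₂ _+_ (cong [_] (p≗q zero)) (count-cong (p≗q ∘ suc))

count-false : ∀ {n} → count {n} (λ _ → false) ≡ 0
count-false {zero}  = refl
count-false {suc n} = count-false {n}

count-≟∧ : ∀ {n} (x : Fin n) b → count (λ z → does (z ≟ x) ∧ b) ≡ [ b ]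
count-≟∧ {suc n} zero    b = trans (cong ([ b ] +_) (count-false {n})) (+-identityʳ [ b ])
count-≟∧ {suc n} (suc x) b = count-≟∧ x b

[]*count : ∀ {n} b (p : Fin n → Bool) → [ b ] * count p ≡ sum (λ z → [ b ∧ p z ])
[]*count     true  p = trans (+-identityʳ (count p)) (count≡sum p)
[]*count {n} false p = sym (sum-replicate-zero n)

[]*-cong : ∀ {b m n} → (b ≡ true → m ≡ n) → [ b ] * m ≡ [ b ] * n
[]*-cong {true}  m≡n = cong (1 *_) (m≡n refl)
[]*-cong {false} _   = refl

count-split : ∀ {n} {p q r : Fin n → Bool} →
              (∀ z → [ p z ] ≡ [ q z ] + [ r z ]) → count p ≡ count q + count r
count-split {p = p} {q} {r} p≗q+r = begin
  count p                        ≡⟨ count≡sum p ⟩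
  sum ([_] ∘ p)                  ≡⟨ sum-cong-≗ p≗q+r ⟩
  sum (λ z → [ q z ] + [ r z ])  ≡⟨ ∑-distrib-+ ([_] ∘ q) ([_] ∘ r) ⟩
  sum ([_] ∘ q) + sum ([_] ∘ r)  ≡⟨ sym (cong₂ _+_ (count≡sum q) (count≡sum r)) ⟩
  count q + count r              ∎

count-split₃ : ∀ {n} {p q r s : Fin n → Bool} →
               (∀ z → [ p z ] ≡ [ q z ] + [ r z ] + [ s z ]) →
               count p ≡ count q + count r + count s
count-split₃ {p = p} {q} {r} {s} p≗q+r+s = begin
  count p
    ≡⟨ count≡sum p ⟩
  sum ([_] ∘ p)
    ≡⟨ sum-cong-≗ p≗q+r+s ⟩
  sum (λ z → [ q z ] + [ r z ] + [ s z ])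
    ≡⟨ ∑-distrib-+ (λ z → [ q z ] + [ r z ]) ([_] ∘ s) ⟩
  sum (λ z → [ q z ] + [ r z ]) + sum ([_] ∘ s)
    ≡⟨ cong (_+ sum ([_] ∘ s)) (∑-distrib-+ ([_] ∘ q) ([_] ∘ r)) ⟩
  sum ([_] ∘ q) + sum ([_] ∘ r) + sum ([_] ∘ s)
    ≡⟨ sym (cong₂ _+_ (cong₂ _+_ (count≡sum q) (count≡sum r)) (count≡sum s)) ⟩
  count q + count r + count s
    ∎

2∤1 : 2 ∤ 1
2∤1 = from-no (2 ∣? 1)

2∤3 : 2 ∤ 3
2∤3 = from-no (2 ∣? 3)

even-count4⇒xor : ∀ a b c d → 2 ∣ count4 a b c d → a ≡ b xor c xor d
even-count4⇒xor true  true  true  true  _    = refl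
even-count4⇒xor true  true  true  false even = contradiction even 2∤3
even-count4⇒xor true  true  false true  even = contradiction even 2∤3
even-count4⇒xor true  true  false false _    = refl
even-count4⇒xor true  false true  true  even = contradiction even 2∤3
even-count4⇒xor true  false true  false _    = refl
even-count4⇒xor true  false false true  _    = refl
even-count4⇒xor true  false false false even = contradiction even 2∤1
even-count4⇒xor false true  true  true  even = contradiction even 2∤3
even-count4⇒xor false true  true  false _    = refl
even-count4⇒xor false true  false true  _    = refl
even-count4⇒xor false true  false false even = contradiction even 2∤1
even-count4⇒xor false false true  true  _    = refl
even-count4⇒xor false false true  false even = contradiction even 2∤1
even-count4⇒xor false false false true  even = contradiction even 2∤1
even-count4⇒xor false false false false _    = refl

record IsTournament {n} (V : Fin n → Bool) (R : Fin n → Fin n → Bool) : Set where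
  field
    irreflexive : ∀ {x} → V x ≡ true → R x x ≡ false
    converse    : ∀ {x y} → V x ≡ true → V y ≡ true → x ≢ y → R y x ≡ not (R x y)

restrict : ∀ {n} {V : Fin n → Bool} {R} (U : Fin n → Bool) →
           IsTournament V R → IsTournament (λ z → V z ∧ U z) R
restrict U T = record
  { irreflexive = irreflexive ∘ ∧-trueˡ
  ; converse    = λ x∈ y∈ → converse (∧-trueˡ x∈) (∧-trueˡ y∈)
  }
  where open IsTournament T

module Tournament {n} {V : Fin n → Bool} {R : Fin n → Fin n → Bool} (T : IsTournament V R) where
  open IsTournament T

  outDegree inDegree : Fin n → ℕ
  outDegree x = count (λ z → V z ∧ R x z)
  inDegree  x = count (λ z → V z ∧ R z x)

  commonOutDegree commonInDegree twoPaths : Fin n → Fin n → ℕ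
  commonOutDegree x y = count (λ z → V z ∧ R x z ∧ R y z)
  commonInDegree  x y = count (λ z → V z ∧ R z x ∧ R z y)
  twoPaths        x y = count (λ z → V z ∧ R x z ∧ R z y)

  commonOutDegree-comm : ∀ x y → commonOutDegree x y ≡ commonOutDegree y x
  commonOutDegree-comm x y = count-cong λ z → cong (V z ∧_) (∧-comm (R x z) (R y z))

  commonOutDegree-diag : ∀ x → commonOutDegree x x ≡ outDegree x
  commonOutDegree-diag x = count-cong λ z → cong (V z ∧_) (∧-idem (R x z))

  arc-dichotomy : ∀ {x y} → V x ≡ true → V y ≡ true → x ≢ y →
                  R x y ≡ true ⊎ R y x ≡ true
  arc-dichotomy {x} {y} x∈ y∈ x≢y with R x y in xy
  ... | true  = inj₁ refl
  ... | false = inj₂ (trans (converse x∈ y∈ x≢y) (cong not xy))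

  outDegree-split : ∀ {u} v → V u ≡ true →
                    outDegree v ≡ [ R v u ] + commonOutDegree v u + twoPaths v u
  outDegree-split {u} v u∈ =
    trans (count-split₃ pointwise)
      (cong (λ k → k + commonOutDegree v u + twoPaths v u) (count-≟∧ u (R v u)))
    where
    pointwise : ∀ z → [ V z ∧ R v z ] ≡
                [ does (z ≟ u) ∧ R v u ] + [ V z ∧ R v z ∧ R u z ] + [ V z ∧ R v z ∧ R z u ]
    pointwise z with z ≟ u
    ... | yes refl rewrite u∈ | irreflexive u∈ with R v z
    ...   | true  = refl
    ...   | false = refl
    pointwise z | no z≢u with V z in z∈
    ...   | false = refl
    ...   | true rewrite converse u∈ z∈ (≢-sym z≢u) = []-split (R v z) (R u z)

  inDegree-split : ∀ u {v} → V v ≡ true →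
                   inDegree u ≡ [ R v u ] + commonInDegree u v + twoPaths v u
  inDegree-split u {v} v∈ =
    trans (count-split₃ pointwise)
      (cong (λ k → k + commonInDegree u v + twoPaths v u) (count-≟∧ v (R v u)))
    where
    pointwise : ∀ z → [ V z ∧ R z u ] ≡
                [ does (z ≟ v) ∧ R v u ] + [ V z ∧ R z u ∧ R z v ] + [ V z ∧ R v z ∧ R z u ]
    pointwise z with z ≟ v
    ... | yes refl rewrite v∈ | irreflexive v∈ with R z u
    ...   | true  = refl
    ...   | false = refl
    pointwise z | no z≢v with V z in z∈
    ...   | false = refl
    ...   | true rewrite converse v∈ z∈ (≢-sym z≢v) with R z u | R v z
    ...     | true  | true  = refl
    ...     | true  | false = refl
    ...     | false | true  = refl
    ...     | false | false = refl

  arc⇒≢ : ∀ {x y} → V x ≡ true → R x y ≡ true → x ≢ y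
  arc⇒≢ x∈ xy refl = contradiction (trans (sym xy) (irreflexive x∈)) λ ()

  reverse-arc : ∀ {u v} → V u ≡ true → V v ≡ true → R u v ≡ true → R v u ≡ false
  reverse-arc u∈ v∈ uv = trans (converse u∈ v∈ (arc⇒≢ u∈ uv)) (cong not uv)

  1+outDegree+inDegree≡count : ∀ {x} → V x ≡ true → 1 + outDegree x + inDegree x ≡ count V
  1+outDegree+inDegree≡count {x} x∈ = sym (trans (count-split₃ pointwise)
    (cong (λ k → k + outDegree x + inDegree x) (trans (count-≟∧ x (V x)) (cong [_] x∈))))
    where
    pointwise : ∀ z → [ V z ] ≡ [ does (z ≟ x) ∧ V x ] + [ V z ∧ R x z ] + [ V z ∧ R z x ]
    pointwise z with z ≟ x
    ... | yes refl rewrite x∈ | irreflexive x∈ = refl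
    ... | no z≢x with V z in z∈
    ...   | false = refl
    ...   | true rewrite converse x∈ z∈ (≢-sym z≢x) = []-split true (R x z)

  handshake : sum (λ x → [ V x ] * outDegree x) ≡ sum (λ x → [ V x ] * inDegree x)
  handshake = begin
    sum (λ x → [ V x ] * outDegree x)
      ≡⟨ sum-cong-≗ (λ x → []*count (V x) (λ z → V z ∧ R x z)) ⟩
    sum (λ x → sum (λ z → [ V x ∧ V z ∧ R x z ]))
      ≡⟨ ∑-comm (λ x z → [ V x ∧ V z ∧ R x z ]) ⟩
    sum (λ z → sum (λ x → [ V x ∧ V z ∧ R x z ]))
      ≡⟨ sum-cong-≗ (λ z → sum-cong-≗ (λ x → cong [_] (x∙yz≈y∙xz (V x) (V z) (R x z)))) ⟩
    sum (λ z → sum (λ x → [ V z ∧ V x ∧ R x z ]))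
      ≡⟨ sum-cong-≗ (λ z → sym ([]*count (V z) (λ x → V x ∧ R x z))) ⟩
    sum (λ z → [ V z ] * inDegree z)
      ∎

  module RegularTournament {d} (outDegree≡d : ∀ {x} → V x ≡ true → outDegree x ≡ d) where
    ∑outDegree : sum (λ x → [ V x ] * outDegree x) ≡ count V * d
    ∑outDegree = begin
      sum (λ x → [ V x ] * outDegree x)  ≡⟨ sum-cong-≗ (λ x → []*-cong (outDegree≡d {x})) ⟩
      sum (λ x → [ V x ] * d)            ≡⟨ sym (*-distribʳ-sum d ([_] ∘ V)) ⟩
      sum ([_] ∘ V) * d                  ≡⟨ cong (_* d) (sym (count≡sum V)) ⟩
      count V * d                        ∎

    count²≡count*[1+2d] : count V * count V ≡ count V * suc (d + d)
    count²≡count*[1+2d] = begin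
      count V * count V
        ≡⟨ cong (_* count V) (count≡sum V) ⟩
      sum ([_] ∘ V) * count V
        ≡⟨ *-distribʳ-sum (count V) ([_] ∘ V) ⟩
      sum (λ x → [ V x ] * count V)
        ≡⟨ sum-cong-≗ (λ x → []*-cong (sym ∘ 1+outDegree+inDegree≡count {x})) ⟩
      sum (λ x → [ V x ] * suc (outDegree x + inDegree x))
        ≡⟨ sum-cong-≗ (λ x → trans (*-suc [ V x ] _) (cong ([ V x ] +_) (*-distribˡ-+ [ V x ] _ _))) ⟩
      sum (λ x → [ V x ] + (Out x + In x))
        ≡⟨ ∑-distrib-+ ([_] ∘ V) (λ x → Out x + In x) ⟩
      sum ([_] ∘ V) + sum (λ x → Out x + In x)
        ≡⟨ cong₂ _+_ (sym (count≡sum V)) (∑-distrib-+ Out In) ⟩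
      count V + (sum Out + sum In)
        ≡⟨ cong (λ s → count V + (sum Out + s)) (sym handshake) ⟩
      count V + (sum Out + sum Out)
        ≡⟨ cong (λ s → count V + (s + s)) ∑outDegree ⟩
      count V + (count V * d + count V * d)
        ≡⟨ cong (count V +_) (sym (*-distribˡ-+ (count V) d d)) ⟩
      count V + count V * (d + d)
        ≡⟨ sym (*-suc (count V) (d + d)) ⟩
      count V * suc (d + d)
        ∎
      where
      Out In : Fin n → ℕ
      Out x = [ V x ] * outDegree x
      In  x = [ V x ] * inDegree x

    count≡1+2d : ∀ {x} → V x ≡ true → count V ≡ suc (d + d)
    count≡1+2d x∈ =
      *-cancelˡ-≡ (count V) (suc (d + d)) (count V) {{count≢0}} count²≡count*[1+2d]
      where
      count≢0 : NonZero (count V)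
      count≢0 = ≢-nonZero λ count≡0 →
        0≢1+n (trans (sym count≡0) (sym (1+outDegree+inDegree≡count x∈)))

    inDegree≡d : ∀ {x} → V x ≡ true → inDegree x ≡ d
    inDegree≡d {x} x∈ = +-cancelˡ-≡ d (inDegree x) d (suc-injective (begin
      suc (d + inDegree x)              ≡⟨ cong (λ o → suc (o + inDegree x)) (sym (outDegree≡d x∈)) ⟩
      1 + outDegree x + inDegree x      ≡⟨ 1+outDegree+inDegree≡count x∈ ⟩
      count V                           ≡⟨ count≡1+2d x∈ ⟩
      suc (d + d)                       ∎))

module Descendent {n} (G : SkewTwoGraph n) (w : Fin n) where

  infix 7 _⇾_

  -- Opaque, so that case splits on z ≟ w cannot rewrite inside the arcs of T_w.
  opaque
    vertex : Fin n → Bool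
    vertex z = not (does (z ≟ w))

    _⇾_ : Fin n → Fin n → Bool
    _⇾_ = arcT G w

  opaque
    unfolding vertex _⇾_

    vertex-w : vertex w ≡ false
    vertex-w with w ≟ w
    ... | yes _   = refl
    ... | no w≢w = contradiction refl w≢w

    vertex? : ∀ z → z ≡ w ⊎ vertex z ≡ true
    vertex? z with z ≟ w
    ... | yes z≡w = inj₁ z≡w
    ... | no _    = inj₂ refl

    ⇾-def : ∀ {x y} → x ⇾ y ≡ vertex x ∧ vertex y ∧ cyc G w x y
    ⇾-def = refl

  vertex⇒≢ : ∀ {x} → vertex x ≡ true → x ≢ w
  vertex⇒≢ x∈ refl = contradiction (trans (sym x∈) vertex-w) λ ()

  ≢⇒vertex : ∀ {x} → x ≢ w → vertex x ≡ true
  ≢⇒vertex {x} x≢w with vertex? x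
  ... | inj₁ x≡w = contradiction x≡w x≢w
  ... | inj₂ x∈  = x∈

  cyc-xyy : ∀ x y → cyc G x y y ≡ false
  cyc-xyy x y = ¬-not λ xyy → proj₁ (proj₂ (only3cyc G x y y xyy)) refl

  cyc-xyx : ∀ x y → cyc G x y x ≡ false
  cyc-xyx x y = ¬-not λ xyx → proj₂ (proj₂ (only3cyc G x y x xyx)) refl

  ⇾≡cyc : ∀ {x y} → vertex x ≡ true → vertex y ≡ true → x ⇾ y ≡ cyc G w x y
  ⇾≡cyc {x} {y} x∈ y∈ rewrite ⇾-def {x} {y} | x∈ | y∈ = refl

  ⇾-irrefl : ∀ x → x ⇾ x ≡ false
  ⇾-irrefl x rewrite ⇾-def {x} {x} | cyc-xyy w x with vertex x
  ... | true  = refl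
  ... | false = refl

  ⇾⇒vertexˡ : ∀ {x y} → x ⇾ y ≡ true → vertex x ≡ true
  ⇾⇒vertexˡ xy = ∧-trueˡ (trans (sym ⇾-def) xy)

  ⇾⇒vertexʳ : ∀ {x y} → x ⇾ y ≡ true → vertex y ≡ true
  ⇾⇒vertexʳ {x} xy = ∧-trueˡ (∧-trueʳ {vertex x} (trans (sym ⇾-def) xy))

  isTournament : IsTournament vertex _⇾_
  isTournament = record
    { irreflexive = λ {x} _ → ⇾-irrefl x
    ; converse    = λ {x} {y} x∈ y∈ x≢y → begin
        y ⇾ x              ≡⟨ ⇾≡cyc y∈ x∈ ⟩
        cyc G w y x        ≡⟨ S1 G w y x (≢-sym (vertex⇒≢ y∈)) (≢-sym x≢y) (≢-sym (vertex⇒≢ x∈)) ⟩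
        not (cyc G w x y)  ≡⟨ cong not (sym (⇾≡cyc x∈ y∈)) ⟩
        not (x ⇾ y)        ∎
    }

  open Tournament isTournament
  open IsTournament isTournament using (converse)

  opaque
    unfolding vertex _⇾_

    commonOut≡commonOutDegree : ∀ x y → commonOut G w x y ≡ commonOutDegree x y
    commonOut≡commonOutDegree x y = refl

  cyc≡xor : ∀ {x y z} → vertex x ≡ true → vertex y ≡ true → vertex z ≡ true →
            x ≢ y → x ≢ z → y ≢ z → cyc G x y z ≡ y ⇾ x xor x ⇾ z xor z ⇾ y
  cyc≡xor {x} {y} {z} x∈ y∈ z∈ x≢y x≢z y≢z = begin
    cyc G x y z
      ≡⟨ even-count4⇒xor _ _ _ _
           (S2 G x y z w x≢y x≢z (vertex⇒≢ x∈) y≢z (vertex⇒≢ y∈) (vertex⇒≢ z∈)) ⟩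
    cyc G x w y xor cyc G x z w xor cyc G y w z
      ≡⟨ cong₂ _xor_ (rotate G x w y)
           (cong₂ _xor_ (trans (rotate G x z w) (rotate G z w x)) (rotate G y w z)) ⟩
    cyc G w y x xor cyc G w x z xor cyc G w z y
      ≡⟨ sym (cong₂ _xor_ (⇾≡cyc y∈ x∈) (cong₂ _xor_ (⇾≡cyc x∈ z∈) (⇾≡cyc z∈ y∈))) ⟩
    y ⇾ x xor x ⇾ z xor z ⇾ y ∎

  cyc-w≡⇾ : ∀ {x y} → vertex x ≡ true → vertex y ≡ true → cyc G x y w ≡ x ⇾ y
  cyc-w≡⇾ {x} {y} x∈ y∈ = trans (trans (rotate G x y w) (rotate G y w x)) (sym (⇾≡cyc x∈ y∈))

  degree-from-w : ∀ {y} → vertex y ≡ true → degree G w y ≡ outDegree y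
  degree-from-w {y} y∈ = count-cong pointwise
    where
    pointwise : ∀ z → cyc G w y z ≡ vertex z ∧ y ⇾ z
    pointwise z with vertex? z
    ... | inj₁ refl rewrite vertex-w = cyc-xyx w y
    ... | inj₂ z∈   rewrite z∈       = sym (⇾≡cyc y∈ z∈)

  degree-to-w : ∀ {x} → vertex x ≡ true → degree G x w ≡ inDegree x
  degree-to-w {x} x∈ = count-cong pointwise
    where
    pointwise : ∀ z → cyc G x w z ≡ vertex z ∧ z ⇾ x
    pointwise z with vertex? z
    ... | inj₁ refl rewrite vertex-w = cyc-xyy x w
    ... | inj₂ z∈   rewrite z∈       = trans (rotate G x w z) (sym (⇾≡cyc z∈ x∈))

  ⇾⇒≢ : ∀ {x y} → x ⇾ y ≡ true → x ≢ y
  ⇾⇒≢ xy = arc⇒≢ (⇾⇒vertexˡ xy) xy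

  module _ {u v} (uv : u ⇾ v ≡ true) where
    private
      u∈ : vertex u ≡ true
      u∈ = ⇾⇒vertexˡ uv

      v∈ : vertex v ≡ true
      v∈ = ⇾⇒vertexʳ uv

      vu : v ⇾ u ≡ false
      vu = reverse-arc u∈ v∈ uv

    outDegree-head : outDegree v ≡ commonOutDegree u v + twoPaths v u
    outDegree-head = begin
      outDegree v
        ≡⟨ outDegree-split v u∈ ⟩
      [ v ⇾ u ] + commonOutDegree v u + twoPaths v u
        ≡⟨ cong (λ b → [ b ] + commonOutDegree v u + twoPaths v u) vu ⟩
      commonOutDegree v u + twoPaths v u
        ≡⟨ cong (_+ twoPaths v u) (commonOutDegree-comm v u) ⟩
      commonOutDegree u v + twoPaths v u
        ∎

    outDegree-tail : outDegree u ≡ suc (commonOutDegree u v + twoPaths u v)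
    outDegree-tail = trans (outDegree-split u v∈)
      (cong (λ b → [ b ] + commonOutDegree u v + twoPaths u v) uv)

    inDegree-tail : inDegree u ≡ commonInDegree u v + twoPaths v u
    inDegree-tail = trans (inDegree-split u v∈)
      (cong (λ b → [ b ] + commonInDegree u v + twoPaths v u) vu)

    degree-along : degree G u v ≡ suc (commonOutDegree u v + commonInDegree u v)
    degree-along = trans (count-split₃ pointwise)
      (cong (λ k → k + commonOutDegree u v + commonInDegree u v)
            (trans (count-≟∧ w (u ⇾ v)) (cong [_] uv)))
      where
      pointwise : ∀ z → [ cyc G u v z ] ≡ [ does (z ≟ w) ∧ u ⇾ v ]
                                          + [ vertex z ∧ u ⇾ z ∧ v ⇾ z ]
                                          + [ vertex z ∧ z ⇾ u ∧ z ⇾ v ]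
      pointwise z with z ≟ w
      ... | yes refl rewrite vertex-w | cyc-w≡⇾ u∈ v∈ | uv = refl
      ... | no z≢w rewrite ≢⇒vertex z≢w with z ≟ u
      ...   | yes refl rewrite cyc-xyx z v | ⇾-irrefl z = refl
      ...   | no z≢u with z ≟ v
      ...     | yes refl rewrite cyc-xyy u z | ⇾-irrefl z | uv | vu = refl
      ...     | no z≢v
        rewrite cyc≡xor u∈ v∈ (≢⇒vertex z≢w) (⇾⇒≢ uv) (≢-sym z≢u) (≢-sym z≢v) | vu
              | converse u∈ (≢⇒vertex z≢w) (≢-sym z≢u) | converse v∈ (≢⇒vertex z≢w) (≢-sym z≢v)
        with u ⇾ z | v ⇾ z
      ...       | true  | true  = refl
      ...       | true  | false = refl
      ...       | false | true  = refl
      ...       | false | false = refl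

    degree-against : degree G v u ≡ twoPaths v u + twoPaths u v
    degree-against = count-split pointwise
      where
      pointwise : ∀ z → [ cyc G v u z ] ≡ [ vertex z ∧ v ⇾ z ∧ z ⇾ u ]
                                          + [ vertex z ∧ u ⇾ z ∧ z ⇾ v ]
      pointwise z with vertex? z
      ... | inj₁ refl rewrite vertex-w | cyc-w≡⇾ v∈ u∈ | vu = refl
      ... | inj₂ z∈ rewrite z∈ with z ≟ v
      ...   | yes refl rewrite cyc-xyx z u | ⇾-irrefl z | uv = refl
      ...   | no z≢v with z ≟ u
      ...     | yes refl rewrite cyc-xyy v z | ⇾-irrefl z | vu = refl
      ...     | no z≢u
        rewrite cyc≡xor v∈ u∈ z∈ (≢-sym (⇾⇒≢ uv)) (≢-sym z≢v) (≢-sym z≢u) | uv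
              | converse v∈ z∈ (≢-sym z≢v) | converse u∈ z∈ (≢-sym z≢u)
        with v ⇾ z | u ⇾ z
      ...       | true  | true  = refl
      ...       | true  | false = refl
      ...       | false | true  = refl
      ...       | false | false = refl

  regular⇒doublyRegular : Regular G → DoublyRegularT G w
  regular⇒doublyRegular (k , degree≡k) = k , ⌊ k /2⌋ , λ x y x≢w y≢w →
      (λ { refl → diagonal x≢w })
    , (λ x≢y → trans (commonOut≡commonOutDegree x y)
                      (offDiagonal (≢⇒vertex x≢w) (≢⇒vertex y≢w) x≢y))
    where
    outDegree≡k : ∀ {y} → vertex y ≡ true → outDegree y ≡ k
    outDegree≡k y∈ = trans (sym (degree-from-w y∈)) (degree≡k w _ (≢-sym (vertex⇒≢ y∈)))

    inDegree≡k : ∀ {x} → vertex x ≡ true → inDegree x ≡ k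
    inDegree≡k x∈ = trans (sym (degree-to-w x∈)) (degree≡k _ w (vertex⇒≢ x∈))

    diagonal : ∀ {x} → x ≢ w → commonOut G w x x ≡ k
    diagonal {x} x≢w = begin
      commonOut G w x x    ≡⟨ commonOut≡commonOutDegree x x ⟩
      commonOutDegree x x  ≡⟨ commonOutDegree-diag x ⟩
      outDegree x          ≡⟨ outDegree≡k (≢⇒vertex x≢w) ⟩
      k                    ∎

    arc-commonOutDegree : ∀ {u v} → u ⇾ v ≡ true → commonOutDegree u v ≡ ⌊ k /2⌋
    arc-commonOutDegree {u} {v} uv = trans (n≡⌈n+n/2⌉ co) (cong ⌊_/2⌋ (sym k≡1+2co))
      where
      co ci : ℕ
      co = commonOutDegree u v
      ci = commonInDegree u v

      co≡ci : co ≡ ci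
      co≡ci = +-cancelʳ-≡ (twoPaths v u) co ci (begin
        co + twoPaths v u  ≡⟨ sym (outDegree-head uv) ⟩
        outDegree v        ≡⟨ outDegree≡k (⇾⇒vertexʳ uv) ⟩
        k                  ≡⟨ sym (inDegree≡k (⇾⇒vertexˡ uv)) ⟩
        inDegree u         ≡⟨ inDegree-tail uv ⟩
        ci + twoPaths v u  ∎)

      k≡1+2co : k ≡ suc (co + co)
      k≡1+2co = begin
        k               ≡⟨ sym (degree≡k u v (⇾⇒≢ uv)) ⟩
        degree G u v    ≡⟨ degree-along uv ⟩
        suc (co + ci)   ≡⟨ cong (λ i → suc (co + i)) (sym co≡ci) ⟩
        suc (co + co)   ∎

    offDiagonal : ∀ {x y} → vertex x ≡ true → vertex y ≡ true → x ≢ y →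
                  commonOutDegree x y ≡ ⌊ k /2⌋
    offDiagonal {x} {y} x∈ y∈ x≢y with arc-dichotomy x∈ y∈ x≢y
    ... | inj₁ xy = arc-commonOutDegree xy
    ... | inj₂ yx = trans (commonOutDegree-comm x y) (arc-commonOutDegree yx)

  doublyRegular⇒regular : DoublyRegularT G w → Regular G
  doublyRegular⇒regular (a , b , doublyRegular) = a , degree≡a
    where
    outDegree≡a : ∀ {x} → vertex x ≡ true → outDegree x ≡ a
    outDegree≡a {x} x∈ = begin
      outDegree x          ≡⟨ sym (commonOutDegree-diag x) ⟩
      commonOutDegree x x  ≡⟨ sym (commonOut≡commonOutDegree x x) ⟩
      commonOut G w x x    ≡⟨ proj₁ (doublyRegular x x (vertex⇒≢ x∈) (vertex⇒≢ x∈)) refl ⟩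
      a                    ∎

    inDegree≡a : ∀ {x} → vertex x ≡ true → inDegree x ≡ a
    inDegree≡a = RegularTournament.inDegree≡d outDegree≡a

    arc-commonOutDegree : ∀ {x y} → x ⇾ y ≡ true → commonOutDegree x y ≡ b
    arc-commonOutDegree {x} {y} xy = begin
      commonOutDegree x y  ≡⟨ sym (commonOut≡commonOutDegree x y) ⟩
      commonOut G w x y    ≡⟨ proj₂ (doublyRegular x y x≢w y≢w) (⇾⇒≢ xy) ⟩
      b                    ∎
      where
      x≢w : x ≢ w
      x≢w = vertex⇒≢ (⇾⇒vertexˡ xy)

      y≢w : y ≢ w
      y≢w = vertex⇒≢ (⇾⇒vertexʳ xy)

    a≡1+2b : ∀ {u v} → u ⇾ v ≡ true → a ≡ suc (b + b)
    a≡1+2b {u} {v} uv = begin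
      a            ≡⟨ sym (outDegree≡a (⇾⇒vertexˡ uv)) ⟩
      outDegree u  ≡⟨ Tournament.RegularTournament.count≡1+2d (restrict (u ⇾_) isTournament)
                        outNeighbourhood-regular (cong₂ _∧_ (⇾⇒vertexʳ uv) uv) ⟩
      suc (b + b)  ∎
      where
      outNeighbourhood-regular : ∀ {y} → vertex y ∧ u ⇾ y ≡ true →
                                 count (λ z → (vertex z ∧ u ⇾ z) ∧ y ⇾ z) ≡ b
      outNeighbourhood-regular {y} y∈ =
        trans (count-cong λ z → ∧-assoc (vertex z) (u ⇾ z) (y ⇾ z))
              (arc-commonOutDegree (∧-trueʳ y∈))

    arc-degree : ∀ {x y} → x ⇾ y ≡ true → degree G x y ≡ a
    arc-degree {x} {y} xy = begin
      degree G x y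
        ≡⟨ degree-along xy ⟩
      suc (commonOutDegree x y + commonInDegree x y)
        ≡⟨ cong₂ (λ o i → suc (o + i)) (arc-commonOutDegree xy) ci≡b ⟩
      suc (b + b)
        ≡⟨ sym (a≡1+2b xy) ⟩
      a
        ∎
      where
      ci≡b : commonInDegree x y ≡ b
      ci≡b = +-cancelʳ-≡ (twoPaths y x) (commonInDegree x y) b (begin
        commonInDegree x y + twoPaths y x   ≡⟨ sym (inDegree-tail xy) ⟩
        inDegree x                          ≡⟨ inDegree≡a (⇾⇒vertexˡ xy) ⟩
        a                                   ≡⟨ sym (outDegree≡a (⇾⇒vertexʳ xy)) ⟩
        outDegree y                         ≡⟨ outDegree-head xy ⟩
        commonOutDegree x y + twoPaths y x  ≡⟨ cong (_+ twoPaths y x) (arc-commonOutDegree xy) ⟩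
        b + twoPaths y x                    ∎)

    reverse-arc-degree : ∀ {x y} → y ⇾ x ≡ true → degree G x y ≡ a
    reverse-arc-degree {x} {y} yx = begin
      degree G x y                        ≡⟨ degree-against yx ⟩
      twoPaths x y + twoPaths y x         ≡⟨ cong (twoPaths x y +_) t≡b ⟩
      twoPaths x y + b                    ≡⟨ +-comm (twoPaths x y) b ⟩
      b + twoPaths x y                    ≡⟨ cong (_+ twoPaths x y) (sym (arc-commonOutDegree yx)) ⟩
      commonOutDegree y x + twoPaths x y  ≡⟨ sym (outDegree-head yx) ⟩
      outDegree x                         ≡⟨ outDegree≡a (⇾⇒vertexʳ yx) ⟩
      a                                   ∎
      where
      t≡b : twoPaths y x ≡ b
      t≡b = +-cancelˡ-≡ b (twoPaths y x) b (suc-injective (begin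
        suc (b + twoPaths y x)
          ≡⟨ cong (λ o → suc (o + twoPaths y x)) (sym (arc-commonOutDegree yx)) ⟩
        suc (commonOutDegree y x + twoPaths y x)  ≡⟨ sym (outDegree-tail yx) ⟩
        outDegree y                               ≡⟨ outDegree≡a (⇾⇒vertexˡ yx) ⟩
        a                                         ≡⟨ a≡1+2b yx ⟩
        suc (b + b)                               ∎))

    degree≡a : ∀ x y → x ≢ y → degree G x y ≡ a
    degree≡a x y x≢y with vertex? x | vertex? y
    ... | inj₁ refl | inj₁ refl = contradiction refl x≢y
    ... | inj₁ refl | inj₂ y∈   = trans (degree-from-w y∈) (outDegree≡a y∈)
    ... | inj₂ x∈   | inj₁ refl = trans (degree-to-w x∈) (inDegree≡a x∈)
    ... | inj₂ x∈   | inj₂ y∈ with arc-dichotomy x∈ y∈ x≢y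
    ...   | inj₁ xy = arc-degree xy
    ...   | inj₂ yx = reverse-arc-degree yx

lemma3p1 : ∀ (n : ℕ) (G : SkewTwoGraph n) (w : Fin n) →
             Regular G ⇔ DoublyRegularT G w
lemma3p1 n G w = mk⇔ regular⇒doublyRegular doublyRegular⇒regular
  where open Descendent G w
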